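{- Let $n\geq 2$ and $v\geq 2$ be integers. Then the graph $\Gamma'(n,v)$ defined below is weakly $(n,v)$-clique-partitioned and has exactly $\binom{nv}{2}-\frac{n(n-1)v}{2}$ edges; hence the upper bound $\binom{nv}{2}-\frac{n(n-1)v}{2}$ on the number of edges of a weakly $(n,v)$-clique-partitioned graph is attained.
   Context: The graph $\Gamma'(n,v)$ has vertex set $\{(i,j):0\leq i\leq n-1,\ 0\leq j\leq v-1\}$ and is obtained from the complete graph on this vertex set by removing all edges joining $(i,0)$ to $(k,\ell)$ for all $i=0,1,\ldots,n-2$, all $k=i+1,\ldots,n-1$ and all $\ell=0,1,\ldots,v-1$. A $v$-clique is a set of $v$ pairwise adjacent vertices. A graph of order $nv$ is weakly $(n,v)$-clique-partitioned if its vertex set can be decomposed in a unique way into $n$ vertex-disjoint $v$-cliques. -}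

module Defs where

open import Data.Nat using (ℕ; zero; suc; _*_; _<ᵇ_; _≡ᵇ_)
open import Data.Bool using (Bool; true; false; _∧_; _∨_; not)
open import Data.Fin using (Fin; toℕ; remQuot; _≟_)
open import Data.List using (List; length; filterᵇ; cartesianProduct; allFin)
open import Data.Product using (_×_; _,_; Σ; proj₁; proj₂)
open import Relation.Nullary.Decidable using (⌊_⌋)
open import Relation.Binary.PropositionalEquality using (_≡_; _≢_)
open import Function.Bundles using (_⇔_)

-- A (simple) graph on the vertex set Fin N, given by its Boolean adjacency
-- relation.  Only pairs of distinct vertices are ever consulted below.
Graph : ℕ → Set
Graph N = Fin N → Fin N → Bool

edgeCount : {N : ℕ} → Graph N → ℕ
edgeCount {N} G =
  length (filterᵇ (λ p → (toℕ (proj₁ p) <ᵇ toℕ (proj₂ p)) ∧ G (proj₁ p) (proj₂ p))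
                  (cartesianProduct (allFin N) (allFin N)))

-- A decomposition of the vertex set of a graph of order n * v into n
-- vertex-disjoint v-cliques, encoded by the map sending each vertex to
-- (the label of) the clique containing it: every label class has exactly
-- v vertices and any two distinct vertices in the same class are adjacent.
IsCliquePartition : (n v : ℕ) → Graph (n * v) → (Fin (n * v) → Fin n) → Set
IsCliquePartition n v G f =
  ((i : Fin n) → length (filterᵇ (λ a → ⌊ f a ≟ i ⌋) (allFin (n * v))) ≡ v)
  × ((a b : Fin (n * v)) → a ≢ b → f a ≡ f b → G a b ≡ true)

-- Two labellings describe the same decomposition iff they induce the
-- same partition of the vertex set (labels of the cliques are irrelevant).
SameDecomposition : {N n : ℕ} → (Fin N → Fin n) → (Fin N → Fin n) → Set
SameDecomposition f g = ∀ a b → (f a ≡ f b) ⇔ (g a ≡ g b)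

WeaklyCliquePartitioned : (n v : ℕ) → Graph (n * v) → Set
WeaklyCliquePartitioned n v G =
  Σ (Fin (n * v) → Fin n) λ f →
    IsCliquePartition n v G f
    × ((g : Fin (n * v) → Fin n) → IsCliquePartition n v G g → SameDecomposition f g)

-- Γ'(n,v) on pairs (i , j), 0 ≤ i < n, 0 ≤ j < v: the complete graph minus
-- all edges joining (i , 0) to (k , ℓ) with i < k.
removedEdge : {n v : ℕ} → Fin n × Fin v → Fin n × Fin v → Bool
removedEdge (i , j) (k , l) = (toℕ j ≡ᵇ 0) ∧ (toℕ i <ᵇ toℕ k)

Γ'-adj : {n v : ℕ} → Fin n × Fin v → Fin n × Fin v → Bool
Γ'-adj x y = not (removedEdge x y ∨ removedEdge y x)

-- Γ'(n,v) as a graph on Fin (n * v), vertex (i , j) being numbered i * v + j.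
Γ' : (n v : ℕ) → Graph (n * v)
Γ' n v a b = not ⌊ a ≟ b ⌋ ∧ Γ'-adj {n} {v} (remQuot {n} v a) (remQuot {n} v b)

-- The rows {(i , j) : j < v} are v-cliques of Γ'(n,v). Given any other
-- decomposition into v-cliques, the clique containing (i , 0) is row i, by
-- strong induction on i: a neighbour of (i , 0) lies in some row k ≤ i, and
-- k < i is impossible, since by induction the clique of (k , 0) is row k and
-- it would then contain (i , 0). Inclusion becomes equality because both
-- sets have v elements. For the edge count, every pair a < b of vertices is
-- either an edge or one of the v · C(n,2) removed pairs (i , 0), (k , l)
-- with i < k, and v · C(n,2) = n(n-1)v/2.
module Submission where

open import Defs
open import Data.Nat using (ℕ; _*_; _∸_; _≤_; _/_)
open import Data.Nat.Combinatorics using (_C_)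
open import Data.Product using (_×_)
open import Relation.Binary.PropositionalEquality using (_≡_)

open import Data.Bool using (Bool; true; false; not; _∧_; _∨_; T; T?)
open import Data.Bool.Properties using (¬-not; ∨-identityʳ; T-≡)
open import Data.Empty using (⊥-elim)
open import Data.Fin as Fin using (Fin; zero; suc; toℕ; remQuot; combine; _↑ˡ_; _↑ʳ_; _≟_)
open import Data.Fin.Properties as Finₚ using (remQuot-combine; combine-remQuot; combine-monoˡ-<; <-irrefl)
open import Data.Fin.Induction using (<-wellFounded)
open import Data.List using (List; length; filterᵇ; cartesianProduct; tabulate; map; _++_)
open import Data.List.Properties using (length-++; filter-++; map-tabulate)
open import Data.Nat as ℕ using (_+_; _<ᵇ_; z≤n)
open import Data.Nat.Combinatorics using (nCk+nC[k+1]≡[n+1]C[k+1]; nC1≡n)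
open import Data.Nat.DivMod using (m*n/n≡m)
open import Data.Nat.Properties as ℕ
  using (+-*-semiring; ≤-refl; +-mono-≤; +-mono-<-≤; ≤-antisym; ≮⇒≥; <⇒≢; +-cancelˡ-≡;
         *-comm; *-assoc; *-identityʳ; +-identityʳ; *-distribʳ-+; *-distribˡ-+; m+n∸n≡m; <ᵇ⇒<; <⇒<ᵇ)
open import Data.Product using (_,_; proj₁; proj₂)
open import Function using (id; _∘_)
open import Function.Bundles using (_⇔_; mk⇔; Equivalence)
open import Induction.WellFounded using (module All)
open import Algebra.Properties.Semiring.Sum +-*-semiring
  using (sum-syntax; sum-cong-≗; ∑-distrib-+; *-distribˡ-sum; sum-replicate-zero)
open import Relation.Nullary using (¬_; yes; no)
open import Relation.Nullary.Decidable using (⌊_⌋; ⌊⌋-map′; dec-no; toWitness; fromWitness)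
open import Relation.Binary.PropositionalEquality
  using (refl; sym; trans; cong; cong₂; subst; subst₂; _≢_; module ≡-Reasoning)

indicator : Bool → ℕ
indicator true  = 1
indicator false = 0

indicator-mono : ∀ {x y} → (T x → T y) → indicator x ≤ indicator y
indicator-mono {false}         _   = z≤n
indicator-mono {true} {true}   _   = ≤-refl
indicator-mono {true} {false} x⇒y = ⊥-elim (x⇒y _)

indicator-injective : ∀ {x y} → indicator x ≡ indicator y → x ≡ y
indicator-injective {true}  {true}  _ = refl
indicator-injective {false} {false} _ = refl

indicator-not+indicator : ∀ x → indicator (not x) + indicator x ≡ 1
indicator-not+indicator true  = refl
indicator-not+indicator false = refl

count : ∀ {N} → (Fin N → Bool) → ℕ
count {N} P = ∑[ a < N ] indicator (P a)

∑-const : ∀ N c → ∑[ i < N ] c ≡ N * c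
∑-const ℕ.zero    c = refl
∑-const (ℕ.suc N) c = cong (c +_) (∑-const N c)

∑-splitAt : ∀ m n (f : Fin (m + n) → ℕ) →
  ∑[ k < m + n ] f k ≡ ∑[ i < m ] f (i ↑ˡ n) + ∑[ j < n ] f (m ↑ʳ j)
∑-splitAt ℕ.zero    n f = refl
∑-splitAt (ℕ.suc m) n f =
  trans (cong (f zero +_) (∑-splitAt m n (f ∘ suc))) (sym (ℕ.+-assoc (f zero) _ _))

∑-combine : ∀ m n (f : Fin (m * n) → ℕ) →
  ∑[ k < m * n ] f k ≡ ∑[ i < m ] ∑[ j < n ] f (combine i j)
∑-combine ℕ.zero    n f = refl
∑-combine (ℕ.suc m) n f =
  trans (∑-splitAt n (m * n) f) (cong (∑[ j < n ] f (j ↑ˡ m * n) +_) (∑-combine m n (f ∘ (n ↑ʳ_))))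

∑-remQuot : ∀ m n (h : Fin m × Fin n → ℕ) →
  ∑[ k < m * n ] h (remQuot {m} n k) ≡ ∑[ i < m ] ∑[ j < n ] h (i , j)
∑-remQuot m n h = trans (∑-combine m n (h ∘ remQuot n))
  (sum-cong-≗ (λ i → sum-cong-≗ (λ j → cong h (remQuot-combine i j))))

∑-mono-≤ : ∀ {N} {f g : Fin N → ℕ} → (∀ i → f i ≤ g i) → ∑[ i < N ] f i ≤ ∑[ i < N ] g i
∑-mono-≤ {ℕ.zero}  f≤g = z≤n
∑-mono-≤ {ℕ.suc N} f≤g = +-mono-≤ (f≤g zero) (∑-mono-≤ (f≤g ∘ suc))

+-mono-≤-≡⇒≡ˡ : ∀ {a b c d} → a ≤ c → b ≤ d → a + b ≡ c + d → a ≡ c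
+-mono-≤-≡⇒≡ˡ a≤c b≤d eq = ≤-antisym a≤c (≮⇒≥ λ a<c → <⇒≢ (+-mono-<-≤ a<c b≤d) eq)

∑-mono-≤-≡⇒≗ : ∀ {N} {f g : Fin N → ℕ} → (∀ i → f i ≤ g i) →
  ∑[ i < N ] f i ≡ ∑[ i < N ] g i → ∀ i → f i ≡ g i
∑-mono-≤-≡⇒≗ {ℕ.suc N} {f} {g} f≤g eq = λ
  { zero    → head≡
  ; (suc i) → ∑-mono-≤-≡⇒≗ (f≤g ∘ suc)
                (+-cancelˡ-≡ (f zero) _ _ (trans eq (cong (_+ _) (sym head≡)))) i
  }
  where
  head≡ : f zero ≡ g zero
  head≡ = +-mono-≤-≡⇒≡ˡ (f≤g zero) (∑-mono-≤ (f≤g ∘ suc)) eq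

count-+ : ∀ {N} (P Q R : Fin N → Bool) →
  (∀ a → indicator (P a) + indicator (Q a) ≡ indicator (R a)) → count P + count Q ≡ count R
count-+ P Q R split = trans (sym (∑-distrib-+ (indicator ∘ P) (indicator ∘ Q))) (sum-cong-≗ split)

count-⊆-≡⇒⊇ : ∀ {N} (P Q : Fin N → Bool) → (∀ a → T (P a) → T (Q a)) →
  count P ≡ count Q → ∀ a → T (Q a) → T (P a)
count-⊆-≡⇒⊇ P Q P⊆Q eq a = subst T (sym (indicator-injective
  (∑-mono-≤-≡⇒≗ (λ b → indicator-mono (P⊆Q b)) eq a)))

count-≟ : ∀ {N} (i : Fin N) → count (λ k → ⌊ k ≟ i ⌋) ≡ 1
count-≟ {ℕ.suc N} zero    = cong ℕ.suc (sum-replicate-zero N)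
count-≟ {ℕ.suc N} (suc i) =
  trans (sum-cong-≗ (λ k → cong indicator (⌊⌋-map′ _ _ (k ≟ i)))) (count-≟ i)

[1+n]C2≡n+nC2 : ∀ n → ℕ.suc n C 2 ≡ n + n C 2
[1+n]C2≡n+nC2 n = trans (sym (nCk+nC[k+1]≡[n+1]C[k+1] n 1)) (cong (_+ n C 2) (nC1≡n n))

count-<ᵇ : ∀ N → ∑[ a < N ] count {N} (λ b → toℕ a <ᵇ toℕ b) ≡ N C 2
count-<ᵇ ℕ.zero    = refl
count-<ᵇ (ℕ.suc N) = begin
  ∑[ b < N ] 1 + ∑[ a < N ] count {N} (λ b → toℕ a <ᵇ toℕ b)  ≡⟨ cong₂ _+_ (∑-const N 1) (count-<ᵇ N) ⟩
  N * 1 + N C 2                                               ≡⟨ cong (_+ N C 2) (*-identityʳ N) ⟩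
  N + N C 2                                                   ≡⟨ [1+n]C2≡n+nC2 N ⟨
  ℕ.suc N C 2                                                 ∎
  where open ≡-Reasoning

[1+n]C2*2≡[1+n]*n : ∀ n → (ℕ.suc n C 2) * 2 ≡ ℕ.suc n * n
[1+n]C2*2≡[1+n]*n ℕ.zero    = refl
[1+n]C2*2≡[1+n]*n (ℕ.suc n) = begin
  ((2 + n) C 2) * 2                   ≡⟨ cong (_* 2) ([1+n]C2≡n+nC2 (ℕ.suc n)) ⟩
  (ℕ.suc n + ℕ.suc n C 2) * 2         ≡⟨ *-distribʳ-+ 2 (ℕ.suc n) (ℕ.suc n C 2) ⟩
  ℕ.suc n * 2 + (ℕ.suc n C 2) * 2     ≡⟨ cong (ℕ.suc n * 2 +_) ([1+n]C2*2≡[1+n]*n n) ⟩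
  ℕ.suc n * 2 + ℕ.suc n * n           ≡⟨ *-distribˡ-+ (ℕ.suc n) 2 n ⟨
  ℕ.suc n * (2 + n)                   ≡⟨ *-comm (ℕ.suc n) (2 + n) ⟩
  (2 + n) * ℕ.suc n                   ∎
  where open ≡-Reasoning

nC2*2≡n*[n∸1] : ∀ n → (n C 2) * 2 ≡ n * (n ∸ 1)
nC2*2≡n*[n∸1] ℕ.zero    = refl
nC2*2≡n*[n∸1] (ℕ.suc n) = [1+n]C2*2≡[1+n]*n n

n*[n∸1]*v/2≡nC2*v : ∀ n v → n * (n ∸ 1) * v / 2 ≡ (n C 2) * v
n*[n∸1]*v/2≡nC2*v n v = begin
  n * (n ∸ 1) * v / 2     ≡⟨ cong (λ m → m * v / 2) (nC2*2≡n*[n∸1] n) ⟨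
  (n C 2) * 2 * v / 2     ≡⟨ cong (_/ 2) (*-assoc (n C 2) 2 v) ⟩
  (n C 2) * (2 * v) / 2   ≡⟨ cong (λ m → (n C 2) * m / 2) (*-comm 2 v) ⟩
  (n C 2) * (v * 2) / 2   ≡⟨ cong (_/ 2) (*-assoc (n C 2) v 2) ⟨
  (n C 2) * v * 2 / 2     ≡⟨ m*n/n≡m ((n C 2) * v) 2 ⟩
  (n C 2) * v             ∎
  where open ≡-Reasoning

length-filterᵇ-tabulate : ∀ {A : Set} {N} (P : A → Bool) (g : Fin N → A) →
  length (filterᵇ P (tabulate g)) ≡ ∑[ i < N ] indicator (P (g i))
length-filterᵇ-tabulate {N = ℕ.zero}  P g = refl
length-filterᵇ-tabulate {N = ℕ.suc N} P g with P (g zero)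
... | true  = cong ℕ.suc (length-filterᵇ-tabulate P (g ∘ suc))
... | false = length-filterᵇ-tabulate P (g ∘ suc)

length-filterᵇ-++ : ∀ {A : Set} (P : A → Bool) (xs ys : List A) →
  length (filterᵇ P (xs ++ ys)) ≡ length (filterᵇ P xs) + length (filterᵇ P ys)
length-filterᵇ-++ P xs ys = trans (cong length (filter-++ (T? ∘ P) xs ys)) (length-++ (filterᵇ P xs))

length-filterᵇ-cartesianProduct :
  ∀ {A B : Set} {M N} (P : A × B → Bool) (g : Fin M → A) (h : Fin N → B) →
  length (filterᵇ P (cartesianProduct (tabulate g) (tabulate h)))
    ≡ ∑[ i < M ] ∑[ j < N ] indicator (P (g i , h j))
length-filterᵇ-cartesianProduct {M = ℕ.zero}  P g h = refl
length-filterᵇ-cartesianProduct {M = ℕ.suc M} {N} P g h = begin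
  length (filterᵇ P (map (g zero ,_) (tabulate h) ++ cartesianProduct (tabulate (g ∘ suc)) (tabulate h)))
    ≡⟨ length-filterᵇ-++ P (map (g zero ,_) (tabulate h)) _ ⟩
  length (filterᵇ P (map (g zero ,_) (tabulate h)))
    + length (filterᵇ P (cartesianProduct (tabulate (g ∘ suc)) (tabulate h)))
    ≡⟨ cong₂ _+_ (trans (cong (length ∘ filterᵇ P) (map-tabulate h (g zero ,_)))
                        (length-filterᵇ-tabulate P (λ j → g zero , h j)))
                 (length-filterᵇ-cartesianProduct P (g ∘ suc) h) ⟩
  ∑[ j < N ] indicator (P (g zero , h j)) + ∑[ i < M ] ∑[ j < N ] indicator (P (g (suc i) , h j))
    ∎
  where open ≡-Reasoning

edgeCount≡∑ : ∀ {N} (G : Graph N) →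
  edgeCount G ≡ ∑[ a < N ] count (λ b → (toℕ a <ᵇ toℕ b) ∧ G a b)
edgeCount≡∑ G = length-filterᵇ-cartesianProduct (λ (a , b) → (toℕ a <ᵇ toℕ b) ∧ G a b) id id

removedEdge⇒< : ∀ {n v} (x y : Fin n × Fin v) → removedEdge x y ≡ true → proj₁ x Fin.< proj₁ y
removedEdge⇒< (i , j) (k , l) e with toℕ j ℕ.≡ᵇ 0
... | true = <ᵇ⇒< (toℕ i) (toℕ k) (Equivalence.from T-≡ e)

module _ (n v′ : ℕ) where

  private
    v : ℕ
    v = ℕ.suc v′

  cell : Fin (n * v) → Fin n × Fin v
  cell = remQuot {n} v

  row : Fin (n * v) → Fin n
  row = proj₁ ∘ cell

  corner : Fin n → Fin (n * v)
  corner i = combine i zero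

  removed : Fin (n * v) → Fin (n * v) → Bool
  removed a b = removedEdge (cell a) (cell b)

  row-corner : ∀ i → row (corner i) ≡ i
  row-corner i = cong proj₁ (remQuot-combine i zero)

  row<⇒< : ∀ {a b} → row a Fin.< row b → a Fin.< b
  row<⇒< {a} {b} r<r = subst₂ Fin._<_ (combine-remQuot {n} v a) (combine-remQuot {n} v b)
    (combine-monoˡ-< (proj₂ (cell a)) (proj₂ (cell b)) r<r)

  removed⇒< : ∀ {a b} → removed a b ≡ true → a Fin.< b
  removed⇒< {a} {b} = row<⇒< ∘ removedEdge⇒< (cell a) (cell b)

  same-row⇒¬removed : ∀ {a b} → row a ≡ row b → removed a b ≡ false
  same-row⇒¬removed {a} {b} ra≡rb =
    ¬-not λ r → <-irrefl ra≡rb (removedEdge⇒< (cell a) (cell b) r)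

  Γ'-unfold : ∀ {a b} → a ≢ b → removed b a ≡ false → Γ' n v a b ≡ not (removed a b)
  Γ'-unfold {a} {b} a≢b ¬rba = begin
    not ⌊ a ≟ b ⌋ ∧ not (removed a b ∨ removed b a)
      ≡⟨ cong₂ (λ d r → not d ∧ not (removed a b ∨ r)) (cong ⌊_⌋ (dec-no (a ≟ b) a≢b)) ¬rba ⟩
    not (removed a b ∨ false)
      ≡⟨ cong not (∨-identityʳ (removed a b)) ⟩
    not (removed a b)
      ∎
    where open ≡-Reasoning

  Γ'⇒¬removed : ∀ {a b} → Γ' n v a b ≡ true → removed a b ≡ false
  Γ'⇒¬removed {a} {b} = adjacent⇒ ⌊ a ≟ b ⌋ (removed a b) (removed b a)
    where
    adjacent⇒ : ∀ d r s → not d ∧ not (r ∨ s) ≡ true → r ≡ false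
    adjacent⇒ false false s _ = refl

  corner-neighbour⇒row≤ : ∀ {i a} → Γ' n v (corner i) a ≡ true → row a Fin.≤ i
  corner-neighbour⇒row≤ {i} {a} adj = ℕ.≮⇒≥ λ i<ra → subst T i≮ra (<⇒<ᵇ i<ra)
    where
    i≮ra : (toℕ i <ᵇ toℕ (row a)) ≡ false
    i≮ra = subst (λ x → removedEdge x (cell a) ≡ false) (remQuot-combine i zero) (Γ'⇒¬removed adj)

  count-row : ∀ i → count (λ a → ⌊ row a ≟ i ⌋) ≡ v
  count-row i = begin
    ∑[ a < n * v ] indicator ⌊ row a ≟ i ⌋        ≡⟨ ∑-remQuot n v (λ x → indicator ⌊ proj₁ x ≟ i ⌋) ⟩
    ∑[ k < n ] ∑[ j < v ] indicator ⌊ k ≟ i ⌋     ≡⟨ sum-cong-≗ (λ k → ∑-const v (indicator ⌊ k ≟ i ⌋)) ⟩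
    ∑[ k < n ] (v * indicator ⌊ k ≟ i ⌋)          ≡⟨ *-distribˡ-sum v (λ k → indicator ⌊ k ≟ i ⌋) ⟨
    v * count (λ k → ⌊ k ≟ i ⌋)                   ≡⟨ cong (v *_) (count-≟ i) ⟩
    v * 1                                         ≡⟨ *-identityʳ v ⟩
    v                                             ∎
    where open ≡-Reasoning

  rows-isCliquePartition : IsCliquePartition n v (Γ' n v) row
  rows-isCliquePartition =
    (λ i → trans (length-filterᵇ-tabulate (λ a → ⌊ row a ≟ i ⌋) id) (count-row i)) ,
    (λ a b a≢b ra≡rb → trans (Γ'-unfold a≢b (same-row⇒¬removed (sym ra≡rb)))
                             (cong not (same-row⇒¬removed ra≡rb)))

  module _ (g : Fin (n * v) → Fin n) (gP : IsCliquePartition n v (Γ' n v) g) where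

    ClassOfCornerIsRow : Fin n → Set
    ClassOfCornerIsRow i = ∀ a → (g a ≡ g (corner i)) ⇔ (row a ≡ i)

    class-of-corner⊆row : ∀ i → (∀ {k} → k Fin.< i → ClassOfCornerIsRow k) →
      ∀ a → g a ≡ g (corner i) → row a ≡ i
    class-of-corner⊆row i IH a ga≡gc with a ≟ corner i
    ... | yes refl = row-corner i
    ... | no  a≢c  = Finₚ.≤-antisym (corner-neighbour⇒row≤ adj) (ℕ.≮⇒≥ row≮i)
      where
      adj : Γ' n v (corner i) a ≡ true
      adj = proj₂ gP (corner i) a (a≢c ∘ sym) (sym ga≡gc)
      row≮i : ¬ row a Fin.< i
      row≮i ra<i = <-irrefl (sym i≡ra) ra<i
        where
        class-of-row-a : ClassOfCornerIsRow (row a)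
        class-of-row-a = IH ra<i
        i≡ra : i ≡ row a
        i≡ra = trans (sym (row-corner i)) (Equivalence.to (class-of-row-a (corner i))
                 (trans (sym ga≡gc) (Equivalence.from (class-of-row-a a) refl)))

    class-of-corner⊇row : ∀ i → (∀ a → g a ≡ g (corner i) → row a ≡ i) →
      ∀ a → row a ≡ i → g a ≡ g (corner i)
    class-of-corner⊇row i ⊆row a ra≡i = toWitness
      (count-⊆-≡⇒⊇ (λ x → ⌊ g x ≟ g (corner i) ⌋) (λ x → ⌊ row x ≟ i ⌋)
        (λ x → fromWitness ∘ ⊆row x ∘ toWitness) (trans count-class (sym (count-row i)))
        a (fromWitness ra≡i))
      where
      count-class : count (λ x → ⌊ g x ≟ g (corner i) ⌋) ≡ v
      count-class = trans (sym (length-filterᵇ-tabulate (λ x → ⌊ g x ≟ g (corner i) ⌋) id))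
                          (proj₁ gP (g (corner i)))

    class-of-corner : ∀ i → ClassOfCornerIsRow i
    class-of-corner = All.wfRec <-wellFounded _ ClassOfCornerIsRow λ i IH a →
      mk⇔ (class-of-corner⊆row i IH a) (class-of-corner⊇row i (class-of-corner⊆row i IH) a)

    rows-sameDecomposition : SameDecomposition row g
    rows-sameDecomposition a b = mk⇔
      (λ ra≡rb → trans (Equivalence.from (C a) refl) (sym (Equivalence.from (C b) (sym ra≡rb))))
      (λ ga≡gb → sym (Equivalence.to (C b) (trans (sym ga≡gb) (Equivalence.from (C a) refl))))
      where
      C : ClassOfCornerIsRow (row a)
      C = class-of-corner (row a)

  Γ'-weaklyCliquePartitioned : WeaklyCliquePartitioned n v (Γ' n v)
  Γ'-weaklyCliquePartitioned = row , rows-isCliquePartition , rows-sameDecomposition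

  pair-split : ∀ a b →
    indicator ((toℕ a <ᵇ toℕ b) ∧ Γ' n v a b) + indicator (removed a b) ≡ indicator (toℕ a <ᵇ toℕ b)
  pair-split a b with toℕ a <ᵇ toℕ b in a<ᵇb
  ... | true  = trans (cong (λ x → indicator x + indicator (removed a b)) (Γ'-unfold a≢b ¬rba))
                      (indicator-not+indicator (removed a b))
    where
    a<b : a Fin.< b
    a<b = <ᵇ⇒< (toℕ a) (toℕ b) (Equivalence.from T-≡ a<ᵇb)
    a≢b : a ≢ b
    a≢b = <⇒≢ a<b ∘ cong toℕ
    ¬rba : removed b a ≡ false
    ¬rba = ¬-not λ r → ℕ.<-asym a<b (removed⇒< r)
  ... | false = cong indicator (¬-not λ r → subst T a<ᵇb (<⇒<ᵇ (removed⇒< r)))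

  removed-count-from-row : ∀ (i : Fin n) →
    ∑[ j < v ] ∑[ k < n ] ∑[ l < v ] indicator (removedEdge (i , j) (k , l))
      ≡ v * count {n} (λ k → toℕ i <ᵇ toℕ k)
  removed-count-from-row i = begin
    ∑[ k < n ] ∑[ l < v ] indicator (toℕ i <ᵇ toℕ k) + ∑[ j < v′ ] ∑[ k < n ] ∑[ l < v ] 0
      ≡⟨ cong (∑[ k < n ] ∑[ l < v ] indicator (toℕ i <ᵇ toℕ k) +_) zeros ⟩
    ∑[ k < n ] ∑[ l < v ] indicator (toℕ i <ᵇ toℕ k) + 0
      ≡⟨ +-identityʳ (∑[ k < n ] ∑[ l < v ] indicator (toℕ i <ᵇ toℕ k)) ⟩
    ∑[ k < n ] ∑[ l < v ] indicator (toℕ i <ᵇ toℕ k)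
      ≡⟨ sum-cong-≗ (λ (k : Fin n) → ∑-const v (indicator (toℕ i <ᵇ toℕ k))) ⟩
    ∑[ k < n ] (v * indicator (toℕ i <ᵇ toℕ k))
      ≡⟨ *-distribˡ-sum v (λ (k : Fin n) → indicator (toℕ i <ᵇ toℕ k)) ⟨
    v * count {n} (λ k → toℕ i <ᵇ toℕ k)
      ∎
    where
    open ≡-Reasoning
    zeros : ∑[ j < v′ ] ∑[ k < n ] ∑[ l < v ] 0 ≡ 0
    zeros = trans (sum-cong-≗ {v′} (λ _ → trans (sum-cong-≗ {n} (λ _ → sum-replicate-zero v))
                                                (sum-replicate-zero n)))
                  (sum-replicate-zero v′)

  removed-count : ∑[ a < n * v ] count (removed a) ≡ (n C 2) * v
  removed-count = begin
    ∑[ a < n * v ] ∑[ b < n * v ] indicator (removedEdge (cell a) (cell b))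
      ≡⟨ ∑-remQuot n v (λ x → ∑[ b < n * v ] indicator (removedEdge x (cell b))) ⟩
    ∑[ i < n ] ∑[ j < v ] ∑[ b < n * v ] indicator (removedEdge (i , j) (cell b))
      ≡⟨ sum-cong-≗ (λ i → sum-cong-≗ (λ j → ∑-remQuot n v (indicator ∘ removedEdge (i , j)))) ⟩
    ∑[ i < n ] ∑[ j < v ] ∑[ k < n ] ∑[ l < v ] indicator (removedEdge (i , j) (k , l))
      ≡⟨ sum-cong-≗ removed-count-from-row ⟩
    ∑[ i < n ] (v * count {n} (λ k → toℕ i <ᵇ toℕ k))
      ≡⟨ *-distribˡ-sum v (λ (i : Fin n) → count {n} (λ k → toℕ i <ᵇ toℕ k)) ⟨
    v * ∑[ i < n ] count {n} (λ k → toℕ i <ᵇ toℕ k)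
      ≡⟨ cong (v *_) (count-<ᵇ n) ⟩
    v * (n C 2)
      ≡⟨ *-comm v (n C 2) ⟩
    (n C 2) * v
      ∎
    where open ≡-Reasoning

  edges+removed≡pairs :
    ∑[ a < n * v ] count (λ b → (toℕ a <ᵇ toℕ b) ∧ Γ' n v a b) + ∑[ a < n * v ] count (removed a)
      ≡ (n * v) C 2
  edges+removed≡pairs = begin
    ∑[ a < n * v ] count (λ b → (toℕ a <ᵇ toℕ b) ∧ Γ' n v a b) + ∑[ a < n * v ] count (removed a)
      ≡⟨ ∑-distrib-+ (λ a → count (λ b → (toℕ a <ᵇ toℕ b) ∧ Γ' n v a b)) (count ∘ removed) ⟨
    ∑[ a < n * v ] (count (λ b → (toℕ a <ᵇ toℕ b) ∧ Γ' n v a b) + count (removed a))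
      ≡⟨ sum-cong-≗ (λ a → count-+ _ (removed a) _ (pair-split a)) ⟩
    ∑[ a < n * v ] count {n * v} (λ b → toℕ a <ᵇ toℕ b)
      ≡⟨ count-<ᵇ (n * v) ⟩
    (n * v) C 2
      ∎
    where open ≡-Reasoning

  Γ'-edgeCount : edgeCount (Γ' n v) ≡ ((n * v) C 2) ∸ ((n * (n ∸ 1) * v) / 2)
  Γ'-edgeCount = begin
    edgeCount (Γ' n v)                        ≡⟨ edgeCount≡∑ (Γ' n v) ⟩
    edges                                     ≡⟨ m+n∸n≡m edges removals ⟨
    edges + removals ∸ removals               ≡⟨ cong₂ _∸_ edges+removed≡pairs removed-count ⟩
    ((n * v) C 2) ∸ (n C 2) * v               ≡⟨ cong ((n * v) C 2 ∸_) (n*[n∸1]*v/2≡nC2*v n v) ⟨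
    ((n * v) C 2) ∸ ((n * (n ∸ 1) * v) / 2)   ∎
    where
    open ≡-Reasoning
    edges removals : ℕ
    edges    = ∑[ a < n * v ] count (λ b → (toℕ a <ᵇ toℕ b) ∧ Γ' n v a b)
    removals = ∑[ a < n * v ] count (removed a)

theorem3p2 : (n v : ℕ) → 2 ≤ n → 2 ≤ v →
    WeaklyCliquePartitioned n v (Γ' n v)
    × edgeCount (Γ' n v) ≡ ((n * v) C 2) ∸ ((n * (n ∸ 1) * v) / 2)
theorem3p2 n (ℕ.suc v′) _ _ = Γ'-weaklyCliquePartitioned n v′ , Γ'-edgeCount n v′
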